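{- Let $\mathbb S$ be a commutative semiring, let $M$ be a $k\times n$ matrix over $\mathbb S$ with rows $\{1,\dots,k\}$ and columns $\{1,\dots,n\}$ in their natural orders, and let $1\le\ell\le n$. For $0\le i\le k$ let $A_i^\ell$ be the submatrix of $M$ with rows $\{1,\dots,i\}$ and columns $\{1,\dots,\ell\}$, and $B_i^\ell$ the submatrix with rows $\{i+1,\dots,k\}$ and columns $\{\ell+1,\dots,n\}$. Then $$\mathrm{perm}'(M)=\sum_{i=0}^k\mathrm{perm}'(A_i^\ell)\cdot\mathrm{perm}'(B_i^\ell).$$
   Context: For a matrix $N$ over $\mathbb S$ with totally ordered row set $R$ and column set $C$, $\mathrm{perm}'(N)=\sum_{g}\prod_{r\in R}N[r,g(r)]$, where $g$ ranges over all strictly increasing functions $g:R\to C$. (For $R=\emptyset$ the only such function is the empty one and the empty product is $1$.) -}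

module Defs where

open import Level using (_⊔_)
open import Algebra.Bundles using (CommutativeSemiring)
open import Data.Nat as ℕ using (ℕ; zero; suc; _∸_)
open import Data.Fin using (Fin; zero; suc; _<_; inject≤; toℕ)
open import Data.Fin.Properties using (all?; _<?_)
open import Data.List using (List; []; _∷_; [_]; map; concatMap; filter; foldr)
open import Data.List.Base using (allFin)
open import Data.Vec.Functional using () renaming (_∷_ to _∷ᶠ_)
open import Relation.Nullary using (Dec)
import Relation.Nullary.Decidable as Dec

allFuns : (k n : ℕ) → List (Fin k → Fin n)
allFuns zero    n = [ (λ ()) ]
allFuns (suc k) n = concatMap (λ j → map (λ g → j ∷ᶠ g) (allFuns k n)) (allFin n)

StrictlyIncreasing : {k n : ℕ} → (Fin k → Fin n) → Set
StrictlyIncreasing {k} g = ∀ (r s : Fin k) → r < s → g r < g s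

strictlyIncreasing? : {k n : ℕ} → (g : Fin k → Fin n) → Dec (StrictlyIncreasing g)
strictlyIncreasing? g =
  all? λ r → all? λ s → (r <? s) Dec.→-dec (g r <? g s)

-- Fin (k ∸ i) → Fin k, r ↦ i + r  (rows/columns i+1,…,k in 1-based terms).
shift : (i k : ℕ) → Fin (k ∸ i) → Fin k
shift zero    k       r = r
shift (suc i) zero    ()
shift (suc i) (suc k) r = suc (shift i k r)

module _ {c ℓ} (S : CommutativeSemiring c ℓ) where
  open CommutativeSemiring S using (Carrier; _+_; _*_; 0#; 1#)

  Matrix : ℕ → ℕ → Set c
  Matrix k n = Fin k → Fin n → Carrier

  sumL : List Carrier → Carrier
  sumL = foldr _+_ 0#

  prodF : (k : ℕ) → (Fin k → Carrier) → Carrier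
  prodF zero    f = 1#
  prodF (suc k) f = f zero * prodF k (λ r → f (suc r))

  perm′ : {k n : ℕ} → Matrix k n → Carrier
  perm′ {k} {n} N =
    sumL (map (λ g → prodF k (λ r → N r (g r)))
              (filter strictlyIncreasing? (allFuns k n)))

  subA : {k n : ℕ} (M : Matrix k n) (i : ℕ) (i≤k : i ℕ.≤ k) (l : ℕ) (l≤n : l ℕ.≤ n) → Matrix i l
  subA M i i≤k l l≤n r s = M (inject≤ r i≤k) (inject≤ s l≤n)

  subB : {k n : ℕ} (M : Matrix k n) (i l : ℕ) → Matrix (k ∸ i) (n ∸ l)
  subB {k} {n} M i l r s = M (shift i k r) (shift l n s)

-- Every strictly increasing g either sends the first row to the first column or avoids
-- that column, so perm′ obeys the column expansion
--   perm′ N = N[1,1] · perm′ (N without row 1 and column 1) + perm′ (N without column 1).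
-- (To see it, perm′ is generalised to the sum over those g whose values are all ≥ b,
-- which expands along the first row and, for b ≥ 1, may drop the first column and lower b.)
-- The splitting identity then follows by induction on ℓ: expanding perm′ M and each
-- perm′ (A_i) along the first column, the induction hypotheses for the two terms of M's
-- expansion produce exactly the two terms of the A_i's expansions, against the same B_i.
module Submission where

open import Defs
open import Algebra.Bundles using (CommutativeSemiring)
open import Data.Nat using (ℕ; _≤_)
open import Data.Fin using (Fin; toℕ)
open import Data.Fin.Properties using (toℕ≤pred[n])
open import Data.List using (map)
open import Data.List.Base using (allFin)

open import Data.Bool.Base using (Bool; true; false; T; if_then_else_; _∧_)
open import Data.Bool.Properties using (T-∧)
open import Data.Fin.Base using (zero; suc)
open import Data.List.Base using (List; []; _∷_; _++_; concatMap; filter; tabulate)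
open import Data.List.Properties using (map-∘; map-tabulate)
open import Data.Nat.Base using (zero; suc; z≤n; s≤s; s≤s⁻¹; _≤ᵇ_)
open import Data.Nat.Properties using (≤-trans; n≤1+n; ≤ᵇ⇒≤; ≤⇒≤ᵇ)
open import Data.Product.Base using (_×_; _,_; proj₁; proj₂)
open import Data.Vec.Functional using (head; tail) renaming (_∷_ to _∷ᶠ_)
open import Function.Bundles using (Equivalence)
open import Relation.Nullary using (does)
open import Relation.Nullary.Decidable.Core using (Dec)
open import Relation.Nullary.Reflects using (det; fromEquivalence)
open import Relation.Unary using (Pred; Decidable)
open import Relation.Binary.PropositionalEquality as ≡ using (_≡_)
import Algebra.Properties.CommutativeSemigroup as CommutativeSemigroupProperties
import Algebra.Properties.Semiring.Sum as SemiringSum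
import Relation.Binary.Reasoning.Setoid as SetoidReasoning

≤ᵇ-suc : ∀ m n → (suc m ≤ᵇ suc n) ≡ (m ≤ᵇ n)
≤ᵇ-suc zero    n = ≡.refl
≤ᵇ-suc (suc m) n = ≡.refl

AllAtLeast : {k n : ℕ} → ℕ → (Fin k → Fin n) → Set
AllAtLeast b g = ∀ r → b ≤ toℕ (g r)

increasingFrom : {k n : ℕ} → ℕ → (Fin k → Fin n) → Bool
increasingFrom {zero}  b g = true
increasingFrom {suc k} b g = (b ≤ᵇ toℕ (head g)) ∧ increasingFrom (suc (toℕ (head g))) (tail g)

increasingFrom-sound : {k n : ℕ} (b : ℕ) (g : Fin k → Fin n) →
  T (increasingFrom b g) → StrictlyIncreasing g × AllAtLeast b g
increasingFrom-sound {zero}  b g _ = (λ ()) , (λ ())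
increasingFrom-sound {suc k} b g t = increasing , atLeast
  where
  t₁,t₂ = Equivalence.to T-∧ t
  b≤g₀ = ≤ᵇ⇒≤ b _ (proj₁ t₁,t₂)
  tail-sound = increasingFrom-sound (suc (toℕ (head g))) (tail g) (proj₂ t₁,t₂)
  increasing : StrictlyIncreasing g
  increasing zero    (suc s) _       = proj₂ tail-sound s
  increasing (suc r) (suc s) (s≤s p) = proj₁ tail-sound r s p
  atLeast : AllAtLeast b g
  atLeast zero    = b≤g₀
  atLeast (suc r) = ≤-trans b≤g₀ (≤-trans (n≤1+n _) (proj₂ tail-sound r))

increasingFrom-complete : {k n : ℕ} (b : ℕ) (g : Fin k → Fin n) →
  StrictlyIncreasing g → AllAtLeast b g → T (increasingFrom b g)
increasingFrom-complete {zero}  b g _ _ = _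
increasingFrom-complete {suc k} b g increasing atLeast = Equivalence.from T-∧
  ( ≤⇒≤ᵇ (atLeast zero)
  , increasingFrom-complete (suc (toℕ (head g))) (tail g)
      (λ r s r<s → increasing (suc r) (suc s) (s≤s r<s))
      (λ r → increasing zero (suc r) (s≤s z≤n)) )

does-strictlyIncreasing? : {k n : ℕ} (g : Fin k → Fin n) →
  does (strictlyIncreasing? g) ≡ increasingFrom 0 g
does-strictlyIncreasing? g = det (Dec.proof (strictlyIncreasing? g)) (fromEquivalence
  (λ t → proj₁ (increasingFrom-sound 0 g t))
  (λ increasing → increasingFrom-complete 0 g increasing (λ _ → z≤n)))

module _ {c ℓ} (S : CommutativeSemiring c ℓ) where
  open CommutativeSemiring S hiding (zero)
  open SemiringSum semiring using (sum; sum-cong-≋; sum-replicate-zero; ∑-distrib-+; *-distribˡ-sum)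
  open CommutativeSemigroupProperties +-commutativeSemigroup using (x∙yz≈y∙xz)
  open SetoidReasoning setoid

  sumL-cong : ∀ {a} {A : Set a} {f g : A → Carrier} (xs : List A) →
    (∀ x → f x ≈ g x) → sumL S (map f xs) ≈ sumL S (map g xs)
  sumL-cong []       f≈g = refl
  sumL-cong (x ∷ xs) f≈g = +-cong (f≈g x) (sumL-cong xs f≈g)

  sumL-zero : ∀ {a} {A : Set a} (xs : List A) → sumL S (map (λ _ → 0#) xs) ≈ 0#
  sumL-zero []       = refl
  sumL-zero (x ∷ xs) = trans (+-identityˡ _) (sumL-zero xs)

  *-distribˡ-sumL : ∀ {a} {A : Set a} (x : Carrier) (f : A → Carrier) (xs : List A) →
    x * sumL S (map f xs) ≈ sumL S (map (λ y → x * f y) xs)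
  *-distribˡ-sumL x f []       = zeroʳ x
  *-distribˡ-sumL x f (y ∷ ys) = trans (distribˡ x _ _) (+-congˡ (*-distribˡ-sumL x f ys))

  sumL-++ : ∀ {a} {A : Set a} (f : A → Carrier) (xs ys : List A) →
    sumL S (map f (xs ++ ys)) ≈ sumL S (map f xs) + sumL S (map f ys)
  sumL-++ f []       ys = sym (+-identityˡ _)
  sumL-++ f (x ∷ xs) ys = trans (+-congˡ (sumL-++ f xs ys)) (sym (+-assoc _ _ _))

  sumL-concatMap : ∀ {a b} {A : Set a} {B : Set b} (f : B → Carrier) (G : A → List B) (xs : List A) →
    sumL S (map f (concatMap G xs)) ≈ sumL S (map (λ x → sumL S (map f (G x))) xs)
  sumL-concatMap f G []       = refl
  sumL-concatMap f G (x ∷ xs) = trans (sumL-++ f (G x) (concatMap G xs)) (+-congˡ (sumL-concatMap f G xs))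

  sumL-filter : ∀ {a p} {A : Set a} {P : Pred A p} (P? : Decidable P) (f : A → Carrier) (xs : List A) →
    sumL S (map f (filter P? xs)) ≈ sumL S (map (λ x → if does (P? x) then f x else 0#) xs)
  sumL-filter P? f []       = refl
  sumL-filter P? f (x ∷ xs) with does (P? x)
  ... | true  = +-congˡ (sumL-filter P? f xs)
  ... | false = trans (sumL-filter P? f xs) (sym (+-identityˡ _))

  sumL-allFin : (n : ℕ) (f : Fin n → Carrier) → sumL S (map f (allFin n)) ≡ sum f
  sumL-allFin n f = ≡.trans (≡.cong (sumL S) (map-tabulate (λ i → i) f)) (sumL-tabulate n f)
    where
    sumL-tabulate : (n : ℕ) (f : Fin n → Carrier) → sumL S (tabulate f) ≡ sum f
    sumL-tabulate zero    f = ≡.refl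
    sumL-tabulate (suc n) f = ≡.cong (f zero +_) (sumL-tabulate n (tail f))

  if-cong : {s t : Bool} {x y : Carrier} → s ≡ t → x ≈ y →
    (if s then x else 0#) ≈ (if t then y else 0#)
  if-cong {true}  ≡.refl x≈y = x≈y
  if-cong {false} ≡.refl _   = refl

  sumL-guarded : ∀ {a} {A : Set a} (t : Bool) (x : Carrier) (p : A → Bool) (f : A → Carrier)
    (ys : List A) →
    sumL S (map (λ y → if t ∧ p y then x * f y else 0#) ys)
      ≈ (if t then x * sumL S (map (λ y → if p y then f y else 0#) ys) else 0#)
  sumL-guarded true  x p f ys =
    sym (trans (*-distribˡ-sumL x _ ys) (sumL-cong ys (λ y → *-distribˡ-if (p y) (f y))))
    where
    *-distribˡ-if : ∀ t z → x * (if t then z else 0#) ≈ (if t then x * z else 0#)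
    *-distribˡ-if true  z = refl
    *-distribˡ-if false z = zeroʳ x
  sumL-guarded false x p f ys = sumL-zero ys

  diagonalProduct : {k n : ℕ} → Matrix S k n → (Fin k → Fin n) → Carrier
  diagonalProduct {k} N g = prodF S k (λ r → N r (g r))

  permFrom : {k n : ℕ} → ℕ → Matrix S k n → Carrier
  permFrom {k} {n} b N =
    sumL S (map (λ g → if increasingFrom b g then diagonalProduct N g else 0#) (allFuns k n))

  perm′≈permFrom : {k n : ℕ} (N : Matrix S k n) → perm′ S N ≈ permFrom 0 N
  perm′≈permFrom {k} {n} N = trans
    (sumL-filter strictlyIncreasing? (diagonalProduct N) (allFuns k n))
    (sumL-cong (allFuns k n) (λ g → if-cong (does-strictlyIncreasing? g) refl))

  permFrom-expandFirstRow : {k n : ℕ} (b : ℕ) (N : Matrix S (suc k) n) →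
    permFrom b N
      ≈ sum (λ j → if b ≤ᵇ toℕ j then head N j * permFrom (suc (toℕ j)) (tail N) else 0#)
  permFrom-expandFirstRow {k} {n} b N = begin
    permFrom b N
      ≈⟨ sumL-concatMap term (λ j → map (j ∷ᶠ_) (allFuns k n)) (allFin n) ⟩
    sumL S (map (λ j → sumL S (map term (map (j ∷ᶠ_) (allFuns k n)))) (allFin n))
      ≡⟨ sumL-allFin n _ ⟩
    sum (λ j → sumL S (map term (map (j ∷ᶠ_) (allFuns k n))))
      ≈⟨ sum-cong-≋ firstValue ⟩
    sum (λ j → if b ≤ᵇ toℕ j then head N j * permFrom (suc (toℕ j)) (tail N) else 0#) ∎
    where
    term : (Fin (suc k) → Fin n) → Carrier
    term g = if increasingFrom b g then diagonalProduct N g else 0#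
    firstValue : ∀ j → sumL S (map term (map (j ∷ᶠ_) (allFuns k n)))
      ≈ (if b ≤ᵇ toℕ j then head N j * permFrom (suc (toℕ j)) (tail N) else 0#)
    firstValue j = trans (reflexive (≡.cong (sumL S) (≡.sym (map-∘ (allFuns k n)))))
      (sumL-guarded (b ≤ᵇ toℕ j) (head N j) (increasingFrom (suc (toℕ j)))
                    (diagonalProduct (tail N)) (allFuns k n))

  dropFirstColumn : {k n : ℕ} → Matrix S k (suc n) → Matrix S k n
  dropFirstColumn N r s = N r (suc s)

  permFrom-dropFirstColumn : {k n : ℕ} (b : ℕ) (N : Matrix S k (suc n)) →
    permFrom (suc b) N ≈ permFrom b (dropFirstColumn N)
  permFrom-dropFirstColumn {zero}  b N = refl
  permFrom-dropFirstColumn {suc k} {n} b N = begin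
    permFrom (suc b) N
      ≈⟨ trans (permFrom-expandFirstRow (suc b) N) (+-identityˡ _) ⟩
    sum {n} (λ j → if suc b ≤ᵇ suc (toℕ j)
                     then N zero (suc j) * permFrom (suc (suc (toℕ j))) (tail N) else 0#)
      ≈⟨ sum-cong-≋ (λ j → if-cong (≤ᵇ-suc b (toℕ j))
           (*-congˡ {N zero (suc j)} (permFrom-dropFirstColumn (suc (toℕ j)) (tail N)))) ⟩
    sum {n} (λ j → if b ≤ᵇ toℕ j
                     then N zero (suc j) * permFrom (suc (toℕ j)) (dropFirstColumn (tail N)) else 0#)
      ≈⟨ permFrom-expandFirstRow b (dropFirstColumn N) ⟨
    permFrom b (dropFirstColumn N) ∎

  permByColumns : {k n : ℕ} → Matrix S k n → Carrier
  permByColumns {zero}  {n}     N = 1#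
  permByColumns {suc k} {zero}  N = 0#
  permByColumns {suc k} {suc n} N =
    head (head N) * permByColumns (dropFirstColumn (tail N)) + permByColumns (dropFirstColumn N)

  permFrom-zero≈permByColumns : {k n : ℕ} (N : Matrix S k n) → permFrom 0 N ≈ permByColumns N
  permFrom-zero≈permByColumns {zero}          N = +-identityʳ 1#
  permFrom-zero≈permByColumns {suc k} {zero}  N = permFrom-expandFirstRow 0 N
  permFrom-zero≈permByColumns {suc k} {suc n} N = begin
    permFrom 0 N
      ≈⟨ permFrom-expandFirstRow 0 N ⟩
    N zero zero * permFrom 1 (tail N)
      + sum (λ j → N zero (suc j) * permFrom (suc (suc (toℕ j))) (tail N))
      ≈⟨ +-cong (*-congˡ (permFrom-dropFirstColumn 0 (tail N)))
                (sum-cong-≋ (λ j → *-congˡ {N zero (suc j)}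
                                   (permFrom-dropFirstColumn (suc (toℕ j)) (tail N)))) ⟩
    N zero zero * permFrom 0 (dropFirstColumn (tail N))
      + sum (λ j → N zero (suc j) * permFrom (suc (toℕ j)) (dropFirstColumn (tail N)))
      ≈⟨ +-congˡ (permFrom-expandFirstRow 0 (dropFirstColumn N)) ⟨
    N zero zero * permFrom 0 (dropFirstColumn (tail N)) + permFrom 0 (dropFirstColumn N)
      ≈⟨ +-cong (*-congˡ (permFrom-zero≈permByColumns (dropFirstColumn (tail N))))
                (permFrom-zero≈permByColumns (dropFirstColumn N)) ⟩
    permByColumns N ∎

  perm′≈permByColumns : {k n : ℕ} (N : Matrix S k n) → perm′ S N ≈ permByColumns N
  perm′≈permByColumns N = trans (perm′≈permFrom N) (permFrom-zero≈permByColumns N)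

  -- The bounds i ≤ k are taken as an arbitrary family so that the induction can pass them
  -- on to the submatrices.
  permByColumns-split : {k n : ℕ} (M : Matrix S k n) (l : ℕ) (l≤n : l ≤ n)
    (i≤k : (i : Fin (suc k)) → toℕ i ≤ k) →
    permByColumns M ≈ sum (λ i → permByColumns (subA S M (toℕ i) (i≤k i) l l≤n)
                                  * permByColumns (subB S M (toℕ i) l))
  permByColumns-split {k} M zero l≤n i≤k = sym (begin
    1# * permByColumns M + sum (λ (i : Fin k) → 0# * permByColumns (subB S M (suc (toℕ i)) 0))
      ≈⟨ +-cong (*-identityˡ _) (trans (sum-cong-≋ {k} (λ _ → zeroˡ _)) (sum-replicate-zero k)) ⟩
    permByColumns M + 0#
      ≈⟨ +-identityʳ _ ⟩
    permByColumns M ∎)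
  permByColumns-split {zero}  {suc n} M (suc l) l≤n i≤k = sym (trans (+-identityʳ _) (*-identityˡ _))
  permByColumns-split {suc k} {suc n} M (suc l) l≤n i≤k = begin
    x * permByColumns M″ + permByColumns M′
      ≈⟨ +-cong (*-congˡ split″) split′ ⟩
    x * sum (λ i → a″ i * b i) + (b₀ + sum (λ i → a′ i * b i))
      ≈⟨ x∙yz≈y∙xz _ _ _ ⟩
    b₀ + (x * sum (λ i → a″ i * b i) + sum (λ i → a′ i * b i))
      ≈⟨ +-congˡ (+-congʳ (*-distribˡ-sum x (λ i → a″ i * b i))) ⟩
    b₀ + (sum (λ i → x * (a″ i * b i)) + sum (λ i → a′ i * b i))
      ≈⟨ +-congˡ (∑-distrib-+ (λ i → x * (a″ i * b i)) (λ i → a′ i * b i)) ⟨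
    b₀ + sum (λ i → x * (a″ i * b i) + a′ i * b i)
      ≈⟨ +-congˡ (sum-cong-≋ {suc k} (λ i → factor (a″ i) (a′ i) (b i))) ⟩
    b₀ + sum (λ i → (x * a″ i + a′ i) * b i) ∎
    where
    x = head (head M)
    M″ = dropFirstColumn (tail M)
    M′ = dropFirstColumn M
    l≤n′ = s≤s⁻¹ l≤n
    split″ = permByColumns-split M″ l l≤n′ (λ i → s≤s⁻¹ (i≤k (suc i)))
    split′ = permByColumns-split M′ l l≤n′ i≤k
    a″ a′ b : Fin (suc k) → Carrier
    a″ i = permByColumns (subA S M″ (toℕ i) (s≤s⁻¹ (i≤k (suc i))) l l≤n′)
    a′ i = permByColumns (subA S M′ (suc (toℕ i)) (i≤k (suc i)) l l≤n′)
    b  i = permByColumns (subB S M″ (toℕ i) l)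
    b₀ = 1# * permByColumns (subB S M′ 0 l)
    factor : ∀ u v w → x * (u * w) + v * w ≈ (x * u + v) * w
    factor u v w = trans (+-congʳ (sym (*-assoc x u w))) (sym (distribʳ w (x * u) v))

  perm′-split : {k n : ℕ} (M : Matrix S k n) (l : ℕ) (l≤n : l ≤ n) →
    perm′ S M ≈ sum (λ (i : Fin (suc k)) → perm′ S (subA S M (toℕ i) (toℕ≤pred[n] i) l l≤n)
                                           * perm′ S (subB S M (toℕ i) l))
  perm′-split {k} M l l≤n = begin
    perm′ S M
      ≈⟨ perm′≈permByColumns M ⟩
    permByColumns M
      ≈⟨ permByColumns-split M l l≤n toℕ≤pred[n] ⟩
    sum (λ (i : Fin (suc k)) → permByColumns (subA S M (toℕ i) (toℕ≤pred[n] i) l l≤n)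
                               * permByColumns (subB S M (toℕ i) l))
      ≈⟨ sum-cong-≋ {suc k} (λ i → *-cong (perm′≈permByColumns (subA S M (toℕ i) (toℕ≤pred[n] i) l l≤n))
                                        (perm′≈permByColumns (subB S M (toℕ i) l))) ⟨
    sum (λ (i : Fin (suc k)) → perm′ S (subA S M (toℕ i) (toℕ≤pred[n] i) l l≤n)
                               * perm′ S (subB S M (toℕ i) l)) ∎

-- The identity holds for l = 0 as well.
lemma1 : ∀ {c ℓ} (S : CommutativeSemiring c ℓ) (k n : ℕ) (M : Matrix S k n) (l : ℕ)
    → 1 ≤ l → (l≤n : l ≤ n)
    → CommutativeSemiring._≈_ S (perm′ S M)
        (sumL S (map (λ (i : Fin (Data.Nat.suc k)) →
           CommutativeSemiring._*_ S
             (perm′ S (subA S M (toℕ i) (toℕ≤pred[n] i) l l≤n))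
             (perm′ S (subB S M (toℕ i) l)))
           (allFin (Data.Nat.suc k))))
lemma1 S k n M l _ l≤n =
  CommutativeSemiring.trans S (perm′-split S M l l≤n)
    (CommutativeSemiring.reflexive S (≡.sym (sumL-allFin S (suc k) _)))
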